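{- Let $q=2^r$, $N=q(q^2-1)$, and let $\{C_j\}_{j=0}^N$ be the weight distribution of the binary code $C(O(3,q))$. Then $C_j=C_{N-j}$ for all $j$ with $0\le j\le N$.
   Context: $q=2^r$ with $r\ge 1$; $\mathbb{F}_q$ is the field with $q$ elements. $O(3,q)$ is the group of all $w\in GL(3,q)$ preserving the quadratic form $\theta(x_1,x_2,x_3)=x_1x_2+x_3^2$ on column vectors $\mathbb{F}_q^{3\times 1}$ (concretely, the matrices $\begin{bmatrix} a&b&0\\ c&d&0\\ g&h&1\end{bmatrix}\in GL(3,q)$ with $ac+g^2=0$, $bd+h^2=0$, $ad+bc=1$); $|O(3,q)|=N$, and $g_1,\dots,g_N$ is a fixed ordering of its elements; $Tr$ is the matrix trace. $C(O(3,q))=\{u\in\mathbb{F}_2^N:\ \sum_{i=1}^N u_i\,Tr\,g_i=0\text{ in }\mathbb{F}_q\}$, and $C_j$ is the number of its codewords of Hamming weight $j$. -}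

module Defs where

open import Level using (0ℓ)
open import Data.Nat as ℕ using (ℕ; _≤_)
open import Data.Bool using (Bool; true; false)
open import Data.Fin using (Fin; zero; suc)
import Data.Fin.Properties as FinP
open import Data.Vec using (Vec; []; _∷_; lookup)
open import Data.List as L using (List; []; _∷_; length; filter; concatMap; map)
open import Data.Product using (_×_; _,_; ∃)
open import Relation.Nullary using (¬_; Dec; yes; no)
open import Relation.Nullary.Decidable using (_×-dec_; ¬?)
open import Relation.Binary.PropositionalEquality using (_≡_; refl; subst; cong)
open import Relation.Binary.Definitions using (DecidableEquality)
open import Algebra.Structures using (IsCommutativeRing)
open import Function.Bundles using (_↔_; Inverse)

record FiniteField : Set₁ where
  infixl 6 _+_
  infixl 7 _*_
  field
    Carrier : Set
    _+_ _*_ : Carrier → Carrier → Carrier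
    -_      : Carrier → Carrier
    0# 1#   : Carrier
    isCommutativeRing : IsCommutativeRing _≡_ _+_ _*_ -_ 0# 1#
    0≢1     : ¬ (0# ≡ 1#)
    inverse : ∀ x → ¬ (x ≡ 0#) → ∃ λ y → x * y ≡ 1#
    size    : ℕ
    enum    : Fin size ↔ Carrier

module _ (F : FiniteField) where
  open FiniteField F
  private
    module E = Inverse enum

  _≟F_ : DecidableEquality Carrier
  x ≟F y with E.from x FinP.≟ E.from y
  ... | yes p = yes (subst₂' p)
    where
      subst₂' : E.from x ≡ E.from y → x ≡ y
      subst₂' p' = trans' (sym' (E.strictlyInverseˡ x))
                          (trans' (cong E.to p') (E.strictlyInverseˡ y))
        where
          open import Relation.Binary.PropositionalEquality
            renaming (trans to trans'; sym to sym')
  ... | no ¬p = no (λ q → ¬p (cong E.from q))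

  allF? : {P : Carrier → Set} → (∀ x → Dec (P x)) → Dec (∀ x → P x)
  allF? {P} P? with FinP.all? (λ i → P? (E.to i))
  ... | yes h = yes (λ x → subst P (E.strictlyInverseˡ x) (h (E.from x)))
  ... | no ¬h = no (λ h → ¬h (λ i → h (E.to i)))

  elems : List Carrier
  elems = map E.to (L.allFin size)

  -- 3×3 matrices over F (row index, column index)
  Mat3 : Set
  Mat3 = Fin 3 → Fin 3 → Carrier

  i0 i1 i2 : Fin 3
  i0 = zero
  i1 = suc zero
  i2 = suc (suc zero)

  mat : Carrier → Carrier → Carrier → Carrier → Carrier → Carrier →
        Carrier → Carrier → Carrier → Mat3
  mat a b c d e f g h i zero zero = a
  mat a b c d e f g h i zero (suc zero) = b
  mat a b c d e f g h i zero (suc (suc zero)) = c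
  mat a b c d e f g h i (suc zero) zero = d
  mat a b c d e f g h i (suc zero) (suc zero) = e
  mat a b c d e f g h i (suc zero) (suc (suc zero)) = f
  mat a b c d e f g h i (suc (suc zero)) zero = g
  mat a b c d e f g h i (suc (suc zero)) (suc zero) = h
  mat a b c d e f g h i (suc (suc zero)) (suc (suc zero)) = i

  allMat3 : List Mat3
  allMat3 =
    concatMap (λ a → concatMap (λ b → concatMap (λ c →
    concatMap (λ d → concatMap (λ e → concatMap (λ f →
    concatMap (λ g → concatMap (λ h → map (λ i →
      mat a b c d e f g h i) elems) elems) elems)
      elems) elems) elems) elems) elems) elems

  det : Mat3 → Carrier
  det w =
      w i0 i0 * (w i1 i1 * w i2 i2 + - (w i1 i2 * w i2 i1))
    + - (w i0 i1 * (w i1 i0 * w i2 i2 + - (w i1 i2 * w i2 i0)))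
    + w i0 i2 * (w i1 i0 * w i2 i1 + - (w i1 i1 * w i2 i0))

  tr : Mat3 → Carrier
  tr w = w i0 i0 + w i1 i1 + w i2 i2

  θ : Carrier → Carrier → Carrier → Carrier
  θ x₁ x₂ x₃ = x₁ * x₂ + x₃ * x₃

  app : Mat3 → Carrier → Carrier → Carrier → Fin 3 → Carrier
  app w x₁ x₂ x₃ i = w i i0 * x₁ + w i i1 * x₂ + w i i2 * x₃

  IsO3 : Mat3 → Set
  IsO3 w = ¬ (det w ≡ 0#)
         × (∀ x₁ x₂ x₃ → θ (app w x₁ x₂ x₃ i0) (app w x₁ x₂ x₃ i1)
                           (app w x₁ x₂ x₃ i2) ≡ θ x₁ x₂ x₃)

  IsO3? : ∀ w → Dec (IsO3 w)
  IsO3? w = ¬? (det w ≟F 0#)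
       ×-dec allF? (λ x₁ → allF? (λ x₂ → allF? (λ x₃ → _ ≟F _)))

  -- the elements g₁,…,g_N of O(3,q) in a fixed order
  O3 : List Mat3
  O3 = filter IsO3? allMat3

  N : ℕ
  N = length O3

  sumF : ∀ {n} → Vec Bool n → Vec Mat3 n → Carrier
  sumF [] [] = 0#
  sumF (true ∷ u) (g ∷ gs) = tr g + sumF u gs
  sumF (false ∷ u) (g ∷ gs) = sumF u gs

  InCode : Vec Bool N → Set
  InCode u = sumF u (Data.Vec.fromList O3) ≡ 0#

  weight : ∀ {n} → Vec Bool n → ℕ
  weight [] = 0
  weight (true ∷ u) = ℕ.suc (weight u)
  weight (false ∷ u) = weight u

  allBoolVecs : ∀ n → List (Vec Bool n)
  allBoolVecs ℕ.zero = [] ∷ []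
  allBoolVecs (ℕ.suc n) =
    map (true ∷_) (allBoolVecs n) L.++ map (false ∷_) (allBoolVecs n)

  C : ℕ → ℕ
  C j = length (filter (λ u → (weight u ℕ.≟ j) ×-dec (sumF u (Data.Vec.fromList O3) ≟F 0#))
                       (allBoolVecs N))

{-# OPTIONS --safe #-}
-- Complementing a word u ∈ 𝔽₂^N sends weight j to N − j and, since q = 2^r forces
-- characteristic 2, adds the total trace T = Σ_{g ∈ O(3,q)} tr g to Σ uᵢ tr gᵢ; so it suffices
-- that T = 0. Writing M = [[a,b,0],[d,e,0],[g,h,1]] ∈ O(3,q) we have tr M = a + e + 1, and each of the
-- three sums vanishes by a pairing argument. The row operations
-- σ₁ : (d,e,g,h) ↦ (d+a, e+b, g+a, h+b) and σ₂ : (a,b,g,h) ↦ (a+d, b+e, g+d, h+e) permute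
-- O(3,q) and fix a, 1 (resp. e). For σ = σ₁ with L = d(e+b) (resp. σ₂ with L = a(b+e)) one has
-- L + L∘σ = ae + bd = 1 on O(3,q), hence Σ φ = Σ φ·(L + L∘σ) = 2 Σ φ·L = 0 for σ-invariant φ.
module Submission where

open import Level using (0ℓ)
open import Defs
open import Data.Nat as ℕ using (ℕ; zero; suc; _≤_; _^_; _∸_)
import Data.Nat.Properties as ℕ
open import Data.Fin using (Fin; zero; suc; #_)
open import Data.List as List using (List; []; _∷_; _++_; concatMap; filter; allFin; tabulate)
import Data.List.Properties as List
open import Data.List.Relation.Binary.Permutation.Propositional using (_↭_; ↭-refl; module PermutationReasoning)
open import Data.List.Relation.Binary.Permutation.Propositional.Properties using (++-comm; ++⁺; map⁺; ↭-length; filter-↭)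
open import Data.Vec as Vec using (Vec; []; _∷_; lookup; _[_]%=_; _[_]≔_; replicate; fromList)
open import Data.Vec.Properties using (lookup∘update′)
open import Data.Product using (_×_; _,_)
open import Data.Sum using (_⊎_; inj₁; inj₂; reduce)
open import Data.Bool using (Bool; true; false; not; if_then_else_; _xor_; _∧_)
open import Data.Maybe using (Maybe; just; nothing)
open import Function using (_∘_; _↔_; Inverse; Equivalence; mk↔ₛ′; _⇔_; mk⇔)
open import Function.Construct.Composition using (_↔-∘_; _⇔-∘_)
open import Function.Construct.Symmetry using (↔-sym; ⇔-sym)
open import Function.Construct.Identity using (⇔-id)
open import Data.Product.Function.NonDependent.Propositional using (_×-⇔_)
open import Relation.Nullary using (¬_; Dec; does; yes; no)
open import Relation.Nullary.Decidable using (does-⇔; _×-dec_)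
open import Relation.Unary using (Pred; _≐_)
open import Relation.Binary.PropositionalEquality
open import Algebra.Bundles using (CommutativeRing; RawRing)
open import Algebra.Solver.Ring.AlmostCommutativeRing using (fromCommutativeRing; _-Raw-AlmostCommutative⟶_)
open import Algebra.Structures using (IsCommutativeRing)
import Algebra.Properties.CommutativeMonoid.Sum as CommutativeMonoidSum
import Algebra.Properties.Semiring.Mult as SemiringMult
import Algebra.Properties.Group as GroupProperties

length-filter-map : {A B : Set} {P : Pred B 0ℓ} (P? : ∀ y → Dec (P y)) (g : A → B) (xs : List A) →
                    List.length (filter P? (List.map g xs)) ≡ List.length (filter (P? ∘ g) xs)
length-filter-map P? g []       = refl
length-filter-map P? g (x ∷ xs) with does (P? (g x))
... | true  = cong suc (length-filter-map P? g xs)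
... | false = length-filter-map P? g xs

≡-substˡ-⇔ : {A : Set} {x x′ y : A} → x′ ≡ x → (x′ ≡ y ⇔ x ≡ y)
≡-substˡ-⇔ x′≡x = mk⇔ (trans (sym x′≡x)) (trans x′≡x)

module BinaryWords (F : FiniteField) where

  complement : ∀ {n} → Vec Bool n → Vec Bool n
  complement = Vec.map not

  weight-complement : ∀ {n} (u : Vec Bool n) → weight F (complement u) ℕ.+ weight F u ≡ n
  weight-complement []          = refl
  weight-complement (true ∷ u)  = trans (ℕ.+-suc _ _) (cong suc (weight-complement u))
  weight-complement (false ∷ u) = cong suc (weight-complement u)

  weight-complement-∸ : ∀ {n} (u : Vec Bool n) → weight F (complement u) ≡ n ∸ weight F u
  weight-complement-∸ u = trans (sym (ℕ.m+n∸n≡m _ (weight F u))) (cong (_∸ weight F u) (weight-complement u))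

  weight≤length : ∀ {n} (u : Vec Bool n) → weight F u ≤ n
  weight≤length u = subst (weight F u ≤_) (weight-complement u) (ℕ.m≤n+m _ _)

  allBoolVecs-↭-complement : ∀ n → allBoolVecs F n ↭ List.map complement (allBoolVecs F n)
  allBoolVecs-↭-complement zero    = ↭-refl
  allBoolVecs-↭-complement (suc n) = begin
    List.map (true ∷_) us ++ List.map (false ∷_) us
      ↭⟨ ++-comm (List.map (true ∷_) us) (List.map (false ∷_) us) ⟩
    List.map (false ∷_) us ++ List.map (true ∷_) us
      ↭⟨ ++⁺ (map⁺ (false ∷_) (allBoolVecs-↭-complement n)) (map⁺ (true ∷_) (allBoolVecs-↭-complement n)) ⟩
    List.map (false ∷_) (List.map complement us) ++ List.map (true ∷_) (List.map complement us)
      ≡⟨ cong₂ _++_ (map-complement-cons true) (map-complement-cons false) ⟩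
    List.map complement (List.map (true ∷_) us) ++ List.map complement (List.map (false ∷_) us)
      ≡⟨ sym (List.map-++ complement (List.map (true ∷_) us) _) ⟩
    List.map complement (List.map (true ∷_) us ++ List.map (false ∷_) us) ∎
    where
    open PermutationReasoning
    us : List (Vec Bool n)
    us = allBoolVecs F n
    map-complement-cons : ∀ b → List.map (not b ∷_) (List.map complement us) ≡ List.map complement (List.map (b ∷_) us)
    map-complement-cons b = trans (sym (List.map-∘ us)) (List.map-∘ us)

  IsCodeword : ∀ {n} → Vec (Mat3 F) n → ℕ → Vec Bool n → Set
  IsCodeword ws j u = weight F u ≡ j × sumF F u ws ≡ FiniteField.0# F

  isCodeword? : ∀ {n} (ws : Vec (Mat3 F) n) j u → Dec (IsCodeword ws j u)
  isCodeword? ws j u = (weight F u ℕ.≟ j) ×-dec (_≟F_ F (sumF F u ws) (FiniteField.0# F))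

  codewordCount : ∀ {n} → Vec (Mat3 F) n → ℕ → ℕ
  codewordCount {n} ws j = List.length (filter (isCodeword? ws j) (allBoolVecs F n))

  codewordCount-symmetric : ∀ {n} (ws : Vec (Mat3 F) n) →
                            (∀ u → sumF F (complement u) ws ≡ sumF F u ws) →
                            ∀ j → j ≤ n → codewordCount ws j ≡ codewordCount ws (n ∸ j)
  codewordCount-symmetric {n} ws sumF∘complement≗sumF j j≤n = sym (begin
    List.length (filter (isCodeword? ws (n ∸ j)) us)
      ≡⟨ ↭-length (filter-↭ (isCodeword? ws (n ∸ j)) (allBoolVecs-↭-complement n)) ⟩
    List.length (filter (isCodeword? ws (n ∸ j)) (List.map complement us))
      ≡⟨ length-filter-map (isCodeword? ws (n ∸ j)) complement us ⟩
    List.length (filter (isCodeword? ws (n ∸ j) ∘ complement) us)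
      ≡⟨ cong List.length (List.filter-≐ (isCodeword? ws (n ∸ j) ∘ complement) (isCodeword? ws j)
                                         (⇔⇒≐ complement-IsCodeword) us) ⟩
    List.length (filter (isCodeword? ws j) us)       ∎)
    where
    open ≡-Reasoning
    us : List (Vec Bool n)
    us = allBoolVecs F n
    complement-IsCodeword : ∀ u → IsCodeword ws (n ∸ j) (complement u) ⇔ IsCodeword ws j u
    complement-IsCodeword u =
      mk⇔ (λ w≡n∸j → ℕ.∸-cancelˡ-≡ (weight≤length u) j≤n (trans (sym (weight-complement-∸ u)) w≡n∸j))
          (λ w≡j → trans (weight-complement-∸ u) (cong (n ∸_) w≡j))
      ×-⇔ ≡-substˡ-⇔ (sumF∘complement≗sumF u)
    ⇔⇒≐ : ∀ {Q R : Pred (Vec Bool n) 0ℓ} → (∀ u → Q u ⇔ R u) → Q ≐ R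
    ⇔⇒≐ Q⇔R = Equivalence.to (Q⇔R _) , Equivalence.from (Q⇔R _)

module FieldSums (F : FiniteField) where
  open FiniteField F
  open BinaryWords F using (complement)
  open IsCommutativeRing isCommutativeRing
    using (+-assoc; +-comm; +-identityˡ; +-identityʳ; *-identityˡ; *-identityʳ; *-comm; *-assoc; zeroˡ; zeroʳ; -‿inverseʳ; -‿inverseˡ)
  private
    module Enum = Inverse enum

  ring : CommutativeRing 0ℓ 0ℓ
  ring = record { isCommutativeRing = isCommutativeRing }

  open CommutativeMonoidSum (CommutativeRing.+-commutativeMonoid ring)
    using (sum; sum-cong-≗; sum-permute; sum-replicate; ∑-distrib-+; ∑-comm)
  open SemiringMult (CommutativeRing.semiring ring) using (×1-homo-*) renaming (_×_ to _·_)
  open GroupProperties (CommutativeRing.+-group ring) using (∙-cancelˡ; ∙-cancelʳ)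

  no-zero-divisors : ∀ x y → x * y ≡ 0# → x ≡ 0# ⊎ y ≡ 0#
  no-zero-divisors x y xy≡0 with _≟F_ F x 0#
  ... | yes x≡0 = inj₁ x≡0
  ... | no x≢0 with inverse x x≢0
  ... | x⁻¹ , xx⁻¹≡1 = inj₂ (begin
    y                ≡⟨ sym (*-identityʳ y) ⟩
    y * 1#           ≡⟨ cong (y *_) (sym xx⁻¹≡1) ⟩
    y * (x * x⁻¹)    ≡⟨ sym (*-assoc y x x⁻¹) ⟩
    y * x * x⁻¹      ≡⟨ cong (_* x⁻¹) (trans (*-comm y x) xy≡0) ⟩
    0# * x⁻¹         ≡⟨ trans (*-comm 0# x⁻¹) (zeroʳ x⁻¹) ⟩
    0#               ∎)
    where open ≡-Reasoning

  +-cancelˡ-≡ : ∀ {p p′ s s′} → p ≡ p′ → p + s ≡ p′ + s′ → s ≡ s′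
  +-cancelˡ-≡ {p} refl = ∙-cancelˡ p _ _

  +-cancelʳ-⇔ : ∀ {x y x′ y′} t → x′ ≡ x + t → y′ ≡ y + t → (x′ ≡ y′ ⇔ x ≡ y)
  +-cancelʳ-⇔ {x} {y} t x′≡x+t y′≡y+t = mk⇔
    (λ x′≡y′ → ∙-cancelʳ t x y (trans (sym x′≡x+t) (trans x′≡y′ y′≡y+t)))
    (λ x≡y → trans x′≡x+t (trans (cong (_+ t) x≡y) (sym y′≡y+t)))

  ΣF : (Carrier → Carrier) → Carrier
  ΣF f = sum (f ∘ Enum.to)

  ΣF-cong : ∀ {f g} → (∀ x → f x ≡ g x) → ΣF f ≡ ΣF g
  ΣF-cong f≗g = sum-cong-≗ (f≗g ∘ Enum.to)

  ΣF-+ : ∀ f g → ΣF (λ x → f x + g x) ≡ ΣF f + ΣF g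
  ΣF-+ f g = ∑-distrib-+ (f ∘ Enum.to) (g ∘ Enum.to)

  ΣF-comm : ∀ (h : Carrier → Carrier → Carrier) → ΣF (λ x → ΣF (h x)) ≡ ΣF (λ y → ΣF (λ x → h x y))
  ΣF-comm h = ∑-comm (λ i j → h (Enum.to i) (Enum.to j))

  ΣF-↔ : (φ : Carrier ↔ Carrier) (f : Carrier → Carrier) → ΣF (f ∘ Inverse.to φ) ≡ ΣF f
  ΣF-↔ φ f = begin
    ΣF (f ∘ Inverse.to φ)
      ≡⟨ sum-permute (f ∘ Inverse.to φ ∘ Enum.to) π ⟩
    sum (f ∘ Inverse.to φ ∘ Enum.to ∘ Inverse.to π)
      ≡⟨ sum-cong-≗ {size} (λ i → cong (f ∘ Inverse.to φ) (Enum.strictlyInverseˡ _)) ⟩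
    sum (f ∘ Inverse.to φ ∘ Inverse.from φ ∘ Enum.to)
      ≡⟨ sum-cong-≗ {size} (λ i → cong f (Inverse.strictlyInverseˡ φ _)) ⟩
    ΣF f
      ∎
    where
    open ≡-Reasoning
    π : Fin size ↔ Fin size
    π = ↔-sym enum ↔-∘ (↔-sym φ ↔-∘ enum)

  translation : Carrier → Carrier ↔ Carrier
  translation t = mk↔ₛ′ (_+ t) (_+ - t) (cancel (- t) t (-‿inverseˡ t)) (cancel t (- t) (-‿inverseʳ t))
    where
    cancel : ∀ s t → s + t ≡ 0# → ∀ x → x + s + t ≡ x
    cancel s t s+t≡0 x = trans (+-assoc x s t) (trans (cong (x +_) s+t≡0) (+-identityʳ x))

  ΣF-translate : ∀ t f → ΣF (λ x → f (x + t)) ≡ ΣF f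
  ΣF-translate t = ΣF-↔ (translation t)

  size·1≡0 : size · 1# ≡ 0#
  size·1≡0 = ∙-cancelˡ (ΣF (λ x → x)) (size · 1#) 0# (begin
    ΣF (λ x → x) + size · 1#      ≡⟨ cong (ΣF (λ x → x) +_) (sym (sum-replicate size)) ⟩
    ΣF (λ x → x) + ΣF (λ _ → 1#)  ≡⟨ sym (ΣF-+ (λ x → x) (λ _ → 1#)) ⟩
    ΣF (λ x → x + 1#)             ≡⟨ ΣF-translate 1# (λ x → x) ⟩
    ΣF (λ x → x)                  ≡⟨ sym (+-identityʳ _) ⟩
    ΣF (λ x → x) + 0#             ∎)
    where open ≡-Reasoning

  characteristic-two : ∀ r → 1 ≤ r → size ≡ 2 ^ r → 1# + 1# ≡ 0#
  characteristic-two (suc r) _ size≡2^r = two-divides r (subst (λ n → n · 1# ≡ 0#) size≡2^r size·1≡0)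
    where
    two·1 : 2 · 1# ≡ 1# + 1#
    two·1 = cong (1# +_) (+-identityʳ 1#)
    two-divides : ∀ r → (2 ^ suc r) · 1# ≡ 0# → 1# + 1# ≡ 0#
    two-divides zero 2·1≡0 = trans (sym two·1) 2·1≡0
    two-divides (suc r) 2^r·1≡0
      with no-zero-divisors (2 · 1#) ((2 ^ suc r) · 1#) (trans (sym (×1-homo-* 2 (2 ^ suc r))) 2^r·1≡0)
    ... | inj₁ 2·1≡0 = trans (sym two·1) 2·1≡0
    ... | inj₂ 2^r·1≡0 = two-divides r 2^r·1≡0

  ΣL : {A : Set} → List A → (A → Carrier) → Carrier
  ΣL xs f = List.foldr (λ x → f x +_) 0# xs

  ΣL-++ : {A : Set} (xs ys : List A) (f : A → Carrier) → ΣL (xs ++ ys) f ≡ ΣL xs f + ΣL ys f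
  ΣL-++ []       ys f = sym (+-identityˡ _)
  ΣL-++ (x ∷ xs) ys f = trans (cong (f x +_) (ΣL-++ xs ys f)) (sym (+-assoc _ _ _))

  ΣL-concatMap : {A B : Set} (g : A → List B) (xs : List A) (f : B → Carrier) →
                 ΣL (concatMap g xs) f ≡ ΣL xs (λ x → ΣL (g x) f)
  ΣL-concatMap g []       f = refl
  ΣL-concatMap g (x ∷ xs) f = trans (ΣL-++ (g x) (concatMap g xs) f) (cong (ΣL (g x) f +_) (ΣL-concatMap g xs f))

  ΣL-map : {A B : Set} (g : A → B) (xs : List A) (f : B → Carrier) → ΣL (List.map g xs) f ≡ ΣL xs (f ∘ g)
  ΣL-map g []       f = refl
  ΣL-map g (x ∷ xs) f = cong (f (g x) +_) (ΣL-map g xs f)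

  ΣL-tabulate : ∀ {n} {A : Set} (g : Fin n → A) (f : A → Carrier) → ΣL (tabulate g) f ≡ sum (f ∘ g)
  ΣL-tabulate {zero}  g f = refl
  ΣL-tabulate {suc n} g f = cong (f (g zero) +_) (ΣL-tabulate (g ∘ suc) f)

  ΣL-elems : ∀ f → ΣL (elems F) f ≡ ΣF f
  ΣL-elems f = trans (ΣL-map Enum.to (allFin size) f) (ΣL-tabulate (λ i → i) (f ∘ Enum.to))

  𝟙 : {P : Set} → Dec P → Carrier
  𝟙 P? = if does P? then 1# else 0#

  𝟙-support : {P : Set} (P? : Dec P) (x y : Carrier) → (P → y ≡ 1#) → 𝟙 P? * x * y ≡ 𝟙 P? * x
  𝟙-support (yes p) x y y≡1 = trans (cong (1# * x *_) (y≡1 p)) (*-identityʳ (1# * x))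
  𝟙-support (no _)  x y _   = trans (*-assoc 0# x y) (trans (zeroˡ (x * y)) (sym (zeroˡ x)))

  ΣL-filter : {A : Set} {P : Pred A 0ℓ} (P? : ∀ x → Dec (P x)) (xs : List A) (f : A → Carrier) →
              ΣL (filter P? xs) f ≡ ΣL xs (λ x → 𝟙 (P? x) * f x)
  ΣL-filter P? []       f = refl
  ΣL-filter P? (x ∷ xs) f with does (P? x)
  ... | true  = cong₂ _+_ (sym (*-identityˡ (f x))) (ΣL-filter P? xs f)
  ... | false = trans (ΣL-filter P? xs f) (sym (trans (cong (_+ ΣL xs (λ y → 𝟙 (P? y) * f y)) (zeroˡ (f x))) (+-identityˡ _)))

  ΣV : ∀ n → (Vec Carrier n → Carrier) → Carrier
  ΣV zero    f = f []
  ΣV (suc n) f = ΣF (λ x → ΣV n (f ∘ (x ∷_)))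

  ΣV-cong : ∀ n {f g : Vec Carrier n → Carrier} → (∀ v → f v ≡ g v) → ΣV n f ≡ ΣV n g
  ΣV-cong zero    f≗g = f≗g []
  ΣV-cong (suc n) f≗g = ΣF-cong (λ x → ΣV-cong n (f≗g ∘ (x ∷_)))

  ΣV-+ : ∀ n (f g : Vec Carrier n → Carrier) → ΣV n (λ v → f v + g v) ≡ ΣV n f + ΣV n g
  ΣV-+ zero    f g = refl
  ΣV-+ (suc n) f g = trans (ΣF-cong (λ x → ΣV-+ n (f ∘ (x ∷_)) (g ∘ (x ∷_))))
                           (ΣF-+ (λ x → ΣV n (f ∘ (x ∷_))) (λ x → ΣV n (g ∘ (x ∷_))))

  ΣF-ΣV-comm : ∀ n (h : Carrier → Vec Carrier n → Carrier) →
               ΣF (λ x → ΣV n (h x)) ≡ ΣV n (λ v → ΣF (λ x → h x v))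
  ΣF-ΣV-comm zero    h = refl
  ΣF-ΣV-comm (suc n) h = trans (ΣF-comm (λ x y → ΣV n (h x ∘ (y ∷_))))
                               (ΣF-cong (λ y → ΣF-ΣV-comm n (λ x → h x ∘ (y ∷_))))

  ΣV-shear : ∀ {n} (k : Fin n) (s : Vec Carrier n → Carrier) → (∀ v y → s (v [ k ]≔ y) ≡ s v) →
             ∀ f → ΣV n (λ v → f (v [ k ]%= (_+ s v))) ≡ ΣV n f
  ΣV-shear {suc n} zero s s-indep f = begin
    ΣF (λ x → ΣV n (λ w → f ((x + s (x ∷ w)) ∷ w)))
      ≡⟨ ΣF-cong (λ x → ΣV-cong n (λ w → cong (λ t → f ((x + t) ∷ w)) (sym (s-indep (x ∷ w) 0#)))) ⟩
    ΣF (λ x → ΣV n (λ w → f ((x + s (0# ∷ w)) ∷ w))) ≡⟨ ΣF-ΣV-comm n (λ x w → f ((x + s (0# ∷ w)) ∷ w)) ⟩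
    ΣV n (λ w → ΣF (λ x → f ((x + s (0# ∷ w)) ∷ w))) ≡⟨ ΣV-cong n (λ w → ΣF-translate (s (0# ∷ w)) (f ∘ (_∷ w))) ⟩
    ΣV n (λ w → ΣF (λ x → f (x ∷ w)))                 ≡⟨ sym (ΣF-ΣV-comm n (λ x w → f (x ∷ w))) ⟩
    ΣV (suc n) f                                       ∎
    where open ≡-Reasoning
  ΣV-shear {suc n} (suc k) s s-indep f =
    ΣF-cong (λ x → ΣV-shear k (s ∘ (x ∷_)) (λ w → s-indep (x ∷ w)) (f ∘ (x ∷_)))

  addCoord : ∀ {n} → Fin n → Fin n → Vec Carrier n → Vec Carrier n
  addCoord k j v = v [ k ]%= (_+ lookup v j)

  record ΣV-Invariant {n} (σ : Vec Carrier n → Vec Carrier n) : Set where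
    field ΣV-∘ : ∀ f → ΣV n (f ∘ σ) ≡ ΣV n f
  open ΣV-Invariant public

  ∘-ΣV-invariant : ∀ {n} {σ τ : Vec Carrier n → Vec Carrier n} →
                   ΣV-Invariant σ → ΣV-Invariant τ → ΣV-Invariant (σ ∘ τ)
  ∘-ΣV-invariant {σ = σ} σ-inv τ-inv .ΣV-∘ f = trans (τ-inv .ΣV-∘ (f ∘ σ)) (σ-inv .ΣV-∘ f)

  addCoord-ΣV-invariant : ∀ {n} (k j : Fin n) → j ≢ k → ΣV-Invariant (addCoord k j)
  addCoord-ΣV-invariant k j j≢k .ΣV-∘ = ΣV-shear k (λ v → lookup v j) (λ v y → lookup∘update′ j≢k v y)

  sumF-ones : (ws : List (Mat3 F)) → sumF F (replicate (List.length ws) true) (fromList ws) ≡ ΣL ws (tr F)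
  sumF-ones []       = refl
  sumF-ones (w ∷ ws) = cong (tr F w +_) (sumF-ones ws)

  sumF-complement : ∀ {n} (u : Vec Bool n) (ws : Vec (Mat3 F) n) →
                    sumF F (complement u) ws + sumF F u ws ≡ sumF F (replicate n true) ws
  sumF-complement []          []       = +-identityˡ 0#
  sumF-complement (true ∷ u)  (w ∷ ws) = begin
    sumF F (complement u) ws + (tr F w + sumF F u ws)   ≡⟨ sym (+-assoc _ (tr F w) _) ⟩
    sumF F (complement u) ws + tr F w + sumF F u ws     ≡⟨ cong (_+ sumF F u ws) (+-comm _ (tr F w)) ⟩
    tr F w + sumF F (complement u) ws + sumF F u ws     ≡⟨ +-assoc (tr F w) _ _ ⟩
    tr F w + (sumF F (complement u) ws + sumF F u ws)   ≡⟨ cong (tr F w +_) (sumF-complement u ws) ⟩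
    tr F w + sumF F (replicate _ true) ws                ∎
    where open ≡-Reasoning
  sumF-complement (false ∷ u) (w ∷ ws) = trans (+-assoc (tr F w) _ _) (cong (tr F w +_) (sumF-complement u ws))

HasCharacteristicTwo : FiniteField → Set
HasCharacteristicTwo F = 1# + 1# ≡ 0#
  where open FiniteField F

module CharacteristicTwo (F : FiniteField) (1+1≡0 : HasCharacteristicTwo F) where
  open FiniteField F
  open FieldSums F
  open BinaryWords F
  open IsCommutativeRing isCommutativeRing
    using (+-assoc; +-comm; +-identityˡ; +-identityʳ; *-identityʳ; distribˡ; zeroˡ; zeroʳ; -‿inverseˡ)

  x+x≡0 : ∀ x → x + x ≡ 0#
  x+x≡0 x = begin
    x + x             ≡⟨ cong₂ _+_ (sym (*-identityʳ x)) (sym (*-identityʳ x)) ⟩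
    x * 1# + x * 1#   ≡⟨ sym (distribˡ x 1# 1#) ⟩
    x * (1# + 1#)     ≡⟨ cong (x *_) 1+1≡0 ⟩
    x * 0#            ≡⟨ zeroʳ x ⟩
    0#                ∎
    where open ≡-Reasoning

  x+y≡0⇒x≡y : ∀ x y → x + y ≡ 0# → x ≡ y
  x+y≡0⇒x≡y x y x+y≡0 = begin
    x               ≡⟨ sym (+-identityʳ x) ⟩
    x + 0#          ≡⟨ cong (x +_) (sym (x+x≡0 y)) ⟩
    x + (y + y)     ≡⟨ sym (+-assoc x y y) ⟩
    x + y + y       ≡⟨ cong (_+ y) x+y≡0 ⟩
    0# + y          ≡⟨ +-identityˡ y ⟩
    y               ∎
    where open ≡-Reasoning

  -x≡x : ∀ x → - x ≡ x
  -x≡x x = sym (x+y≡0⇒x≡y x (- x) (trans (+-comm x (- x)) (-‿inverseˡ x)))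

  private
    𝔽₂ : RawRing 0ℓ 0ℓ
    𝔽₂ = record { Carrier = Bool ; _≈_ = _≡_ ; _+_ = _xor_ ; _*_ = _∧_ ; -_ = λ x → x ; 0# = false ; 1# = true }

    embed : Bool → Carrier
    embed true  = 1#
    embed false = 0#

    embed-hom : 𝔽₂ -Raw-AlmostCommutative⟶ fromCommutativeRing ring
    embed-hom = record
      { ⟦_⟧    = embed
      ; +-homo = λ { true true → sym 1+1≡0 ; true false → sym (+-identityʳ 1#)
                   ; false true → sym (+-identityˡ 1#) ; false false → sym (+-identityˡ 0#) }
      ; *-homo = λ { true true → sym (*-identityʳ 1#) ; true false → sym (zeroʳ 1#)
                   ; false true → sym (zeroˡ 1#) ; false false → sym (zeroˡ 0#) }
      ; -‿homo = λ x → sym (-x≡x (embed x))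
      ; 0-homo = refl
      ; 1-homo = refl
      }

    embed-≟ : ∀ a b → Maybe (embed a ≡ embed b)
    embed-≟ true  true  = just refl
    embed-≟ false false = just refl
    embed-≟ _     _     = nothing

  -- Coefficients in 𝔽₂ = Bool make the ring solver decide identities of characteristic 2.
  open import Algebra.Solver.Ring 𝔽₂ (fromCommutativeRing ring) embed-hom embed-≟
    using (solve; _:=_; _:+_; _:*_; :-_; con; Polynomial)

  private
    O I : ∀ {n} → Polynomial n
    O = con false
    I = con true

  ΣV-pairing : ∀ {n} (σ : Vec Carrier n → Vec Carrier n) → ΣV-Invariant σ →
               (ψ L : Vec Carrier n → Carrier) → (∀ v → ψ (σ v) ≡ ψ v) →
               (∀ v → ψ v * (L v + L (σ v)) ≡ ψ v) → ΣV n ψ ≡ 0#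
  ΣV-pairing {n} σ σ-inv ψ L ψ∘σ≗ψ ψ-split = begin
    ΣV n ψ                                ≡⟨ ΣV-cong n (λ v → sym (split v)) ⟩
    ΣV n (λ v → ψL v + ψL (σ v))          ≡⟨ ΣV-+ n ψL (ψL ∘ σ) ⟩
    ΣV n ψL + ΣV n (ψL ∘ σ)               ≡⟨ cong (ΣV n ψL +_) (σ-inv .ΣV-∘ ψL) ⟩
    ΣV n ψL + ΣV n ψL                     ≡⟨ x+x≡0 (ΣV n ψL) ⟩
    0#                                    ∎
    where
    open ≡-Reasoning
    ψL : Vec Carrier n → Carrier
    ψL v = ψ v * L v
    split : ∀ v → ψL v + ψL (σ v) ≡ ψ v
    split v = trans (cong (λ t → ψL v + t * L (σ v)) (ψ∘σ≗ψ v))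
                    (trans (sym (distribˡ (ψ v) (L v) (L (σ v)))) (ψ-split v))

  toMat : Vec Carrier 9 → Mat3 F
  toMat v = mat F (lookup v (# 0)) (lookup v (# 1)) (lookup v (# 2))
                  (lookup v (# 3)) (lookup v (# 4)) (lookup v (# 5))
                  (lookup v (# 6)) (lookup v (# 7)) (lookup v (# 8))

  ΣL-allMat3 : ∀ φ → ΣL (allMat3 F) φ ≡ ΣV 9 (φ ∘ toMat)
  ΣL-allMat3 φ =
    step λ a → step λ b → step λ c → step λ d → step λ e → step λ f → step λ g → step λ h →
    trans (ΣL-map (mat F a b c d e f g h) (elems F) φ) (ΣL-elems _)
    where
    step : {ws : Carrier → List (Mat3 F)} {s : Carrier → Carrier} →
           (∀ x → ΣL (ws x) φ ≡ s x) → ΣL (concatMap ws (elems F)) φ ≡ ΣF s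
    step {ws} ws≡s = trans (ΣL-concatMap ws (elems F) φ) (trans (ΣL-elems _) (ΣF-cong ws≡s))

  record TernaryQuadraticForm : Set where
    constructor quadratic
    field c₁₁ c₂₂ c₃₃ c₁₂ c₁₃ c₂₃ : Carrier

  evalQ : TernaryQuadraticForm → Carrier → Carrier → Carrier → Carrier
  evalQ (quadratic c₁₁ c₂₂ c₃₃ c₁₂ c₁₃ c₂₃) x₁ x₂ x₃ =
    c₁₁ * (x₁ * x₁) + c₂₂ * (x₂ * x₂) + c₃₃ * (x₃ * x₃) + c₁₂ * (x₁ * x₂) + c₁₃ * (x₁ * x₃) + c₂₃ * (x₂ * x₃)

  θ-form : TernaryQuadraticForm
  θ-form = quadratic 0# 0# 1# 1# 0# 0#

  θ≡evalQ-θ-form : ∀ x₁ x₂ x₃ → θ F x₁ x₂ x₃ ≡ evalQ θ-form x₁ x₂ x₃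
  θ≡evalQ-θ-form = solve 3 (λ x₁ x₂ x₃ → x₁ :* x₂ :+ x₃ :* x₃ :=
    O :* (x₁ :* x₁) :+ O :* (x₂ :* x₂) :+ I :* (x₃ :* x₃) :+ I :* (x₁ :* x₂) :+ O :* (x₁ :* x₃) :+ O :* (x₂ :* x₃)) refl

  θ-pullback : Vec Carrier 9 → TernaryQuadraticForm
  θ-pullback (a ∷ b ∷ c ∷ d ∷ e ∷ f ∷ g ∷ h ∷ i ∷ []) =
    quadratic (a * d + g * g) (b * e + h * h) (c * f + i * i) (a * e + b * d) (a * f + c * d) (b * f + c * e)

  θ∘ : Mat3 F → Carrier → Carrier → Carrier → Carrier
  θ∘ w x₁ x₂ x₃ = θ F (app F w x₁ x₂ x₃ (i0 F)) (app F w x₁ x₂ x₃ (i1 F)) (app F w x₁ x₂ x₃ (i2 F))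

  Preservesθ : Mat3 F → Set
  Preservesθ w = ∀ x₁ x₂ x₃ → θ∘ w x₁ x₂ x₃ ≡ θ F x₁ x₂ x₃

  θ∘toMat : ∀ v x₁ x₂ x₃ → θ∘ (toMat v) x₁ x₂ x₃ ≡ evalQ (θ-pullback v) x₁ x₂ x₃
  θ∘toMat (a ∷ b ∷ c ∷ d ∷ e ∷ f ∷ g ∷ h ∷ i ∷ []) = solve 12 (λ a b c d e f g h i x₁ x₂ x₃ →
    (a :* x₁ :+ b :* x₂ :+ c :* x₃) :* (d :* x₁ :+ e :* x₂ :+ f :* x₃) :+ (g :* x₁ :+ h :* x₂ :+ i :* x₃) :* (g :* x₁ :+ h :* x₂ :+ i :* x₃)
    := (a :* d :+ g :* g) :* (x₁ :* x₁) :+ (b :* e :+ h :* h) :* (x₂ :* x₂) :+ (c :* f :+ i :* i) :* (x₃ :* x₃)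
       :+ (a :* e :+ b :* d) :* (x₁ :* x₂) :+ (a :* f :+ c :* d) :* (x₁ :* x₃) :+ (b :* f :+ c :* e) :* (x₂ :* x₃)) refl a b c d e f g h i

  quadratic-cong : ∀ {p q r s t u p′ q′ r′ s′ t′ u′} → p ≡ p′ → q ≡ q′ → r ≡ r′ → s ≡ s′ → t ≡ t′ → u ≡ u′ →
                   quadratic p q r s t u ≡ quadratic p′ q′ r′ s′ t′ u′
  quadratic-cong refl refl refl refl refl refl = refl

  evalQ-injective : ∀ κ κ′ → (∀ x₁ x₂ x₃ → evalQ κ x₁ x₂ x₃ ≡ evalQ κ′ x₁ x₂ x₃) → κ ≡ κ′
  evalQ-injective κ κ′ κ≗κ′ = quadratic-cong c₁₁≡ c₂₂≡ c₃₃≡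
      (+-cancelˡ-≡ (cong₂ _+_ c₁₁≡ c₂₂≡) (values 1# 1# 0# at₁₁₀))
      (+-cancelˡ-≡ (cong₂ _+_ c₁₁≡ c₃₃≡) (values 1# 0# 1# at₁₀₁))
      (+-cancelˡ-≡ (cong₂ _+_ c₂₂≡ c₃₃≡) (values 0# 1# 1# at₀₁₁))
    where
    open TernaryQuadraticForm
    values : ∀ x₁ x₂ x₃ {g : TernaryQuadraticForm → Carrier} → (∀ κ → evalQ κ x₁ x₂ x₃ ≡ g κ) → g κ ≡ g κ′
    values x₁ x₂ x₃ {g} at = trans (sym (at κ)) (trans (κ≗κ′ x₁ x₂ x₃) (at κ′))
    at₁₀₀ : ∀ κ → evalQ κ 1# 0# 0# ≡ c₁₁ κ
    at₁₀₀ (quadratic p q r s t u) = solve 6 (λ p q r s t u →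
      p :* (I :* I) :+ q :* (O :* O) :+ r :* (O :* O) :+ s :* (I :* O) :+ t :* (I :* O) :+ u :* (O :* O) := p) refl p q r s t u
    at₀₁₀ : ∀ κ → evalQ κ 0# 1# 0# ≡ c₂₂ κ
    at₀₁₀ (quadratic p q r s t u) = solve 6 (λ p q r s t u →
      p :* (O :* O) :+ q :* (I :* I) :+ r :* (O :* O) :+ s :* (O :* I) :+ t :* (O :* O) :+ u :* (I :* O) := q) refl p q r s t u
    at₀₀₁ : ∀ κ → evalQ κ 0# 0# 1# ≡ c₃₃ κ
    at₀₀₁ (quadratic p q r s t u) = solve 6 (λ p q r s t u →
      p :* (O :* O) :+ q :* (O :* O) :+ r :* (I :* I) :+ s :* (O :* O) :+ t :* (O :* I) :+ u :* (O :* I) := r) refl p q r s t u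
    at₁₁₀ : ∀ κ → evalQ κ 1# 1# 0# ≡ c₁₁ κ + c₂₂ κ + c₁₂ κ
    at₁₁₀ (quadratic p q r s t u) = solve 6 (λ p q r s t u →
      p :* (I :* I) :+ q :* (I :* I) :+ r :* (O :* O) :+ s :* (I :* I) :+ t :* (I :* O) :+ u :* (I :* O) := p :+ q :+ s) refl p q r s t u
    at₁₀₁ : ∀ κ → evalQ κ 1# 0# 1# ≡ c₁₁ κ + c₃₃ κ + c₁₃ κ
    at₁₀₁ (quadratic p q r s t u) = solve 6 (λ p q r s t u →
      p :* (I :* I) :+ q :* (O :* O) :+ r :* (I :* I) :+ s :* (I :* O) :+ t :* (I :* I) :+ u :* (O :* I) := p :+ r :+ t) refl p q r s t u
    at₀₁₁ : ∀ κ → evalQ κ 0# 1# 1# ≡ c₂₂ κ + c₃₃ κ + c₂₃ κ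
    at₀₁₁ (quadratic p q r s t u) = solve 6 (λ p q r s t u →
      p :* (O :* O) :+ q :* (I :* I) :+ r :* (I :* I) :+ s :* (O :* I) :+ t :* (O :* I) :+ u :* (I :* I) := q :+ r :+ u) refl p q r s t u
    c₁₁≡ : c₁₁ κ ≡ c₁₁ κ′
    c₁₁≡ = values 1# 0# 0# at₁₀₀
    c₂₂≡ : c₂₂ κ ≡ c₂₂ κ′
    c₂₂≡ = values 0# 1# 0# at₀₁₀
    c₃₃≡ : c₃₃ κ ≡ c₃₃ κ′
    c₃₃≡ = values 0# 0# 1# at₀₀₁

  Preservesθ⇔θ-pullback≡θ-form : ∀ v → Preservesθ (toMat v) ⇔ θ-pullback v ≡ θ-form
  Preservesθ⇔θ-pullback≡θ-form v = mk⇔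
    (λ pres → evalQ-injective (θ-pullback v) θ-form
                (λ x₁ x₂ x₃ → trans (sym (θ∘toMat v x₁ x₂ x₃)) (trans (pres x₁ x₂ x₃) (θ≡evalQ-θ-form x₁ x₂ x₃))))
    (λ eq x₁ x₂ x₃ → trans (θ∘toMat v x₁ x₂ x₃)
                       (trans (cong (λ κ → evalQ κ x₁ x₂ x₃) eq) (sym (θ≡evalQ-θ-form x₁ x₂ x₃))))

  -- In the notation [[a,b,0],[c,d,0],[g,h,1]] of the paper: ac + g² = 0, bd + h² = 0, ad + bc = 1.
  IsO3Form : Vec Carrier 9 → Set
  IsO3Form (a ∷ b ∷ c ∷ d ∷ e ∷ f ∷ g ∷ h ∷ i ∷ []) =
    c ≡ 0# × f ≡ 0# × i ≡ 1# × a * d ≡ g * g × b * e ≡ h * h × a * e + b * d ≡ 1#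

  θ-pullback≡θ-form⇔IsO3Form : ∀ v → θ-pullback v ≡ θ-form ⇔ IsO3Form v
  θ-pullback≡θ-form⇔IsO3Form v@(a ∷ b ∷ c ∷ d ∷ e ∷ f ∷ g ∷ h ∷ i ∷ []) = mk⇔ to from
    where
    open TernaryQuadraticForm
    to : θ-pullback v ≡ θ-form → IsO3Form v
    to eq = c≡0 , f≡0 , i≡1 , x+y≡0⇒x≡y _ _ (cong c₁₁ eq) , x+y≡0⇒x≡y _ _ (cong c₂₂ eq) , cong c₁₂ eq
      where
      open ≡-Reasoning
      c≡0 : c ≡ 0#
      c≡0 = begin
        c                                      ≡⟨ sym (*-identityʳ c) ⟩
        c * 1#                                 ≡⟨ cong (c *_) (sym (cong c₁₂ eq)) ⟩
        c * (a * e + b * d)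
          ≡⟨ solve 6 (λ a b c d e f → c :* (a :* e :+ b :* d) := b :* (a :* f :+ c :* d) :+ a :* (b :* f :+ c :* e)) refl a b c d e f ⟩
        b * (a * f + c * d) + a * (b * f + c * e) ≡⟨ cong₂ (λ s t → b * s + a * t) (cong c₁₃ eq) (cong c₂₃ eq) ⟩
        b * 0# + a * 0#                        ≡⟨ solve 2 (λ a b → b :* O :+ a :* O := O) refl a b ⟩
        0#                                     ∎
      f≡0 : f ≡ 0#
      f≡0 = begin
        f                                      ≡⟨ sym (*-identityʳ f) ⟩
        f * 1#                                 ≡⟨ cong (f *_) (sym (cong c₁₂ eq)) ⟩
        f * (a * e + b * d)
          ≡⟨ solve 6 (λ a b c d e f → f :* (a :* e :+ b :* d) := e :* (a :* f :+ c :* d) :+ d :* (b :* f :+ c :* e)) refl a b c d e f ⟩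
        e * (a * f + c * d) + d * (b * f + c * e) ≡⟨ cong₂ (λ s t → e * s + d * t) (cong c₁₃ eq) (cong c₂₃ eq) ⟩
        e * 0# + d * 0#                        ≡⟨ solve 2 (λ d e → e :* O :+ d :* O := O) refl d e ⟩
        0#                                     ∎
      [i+1]²≡0 : (i + 1#) * (i + 1#) ≡ 0#
      [i+1]²≡0 = begin
        (i + 1#) * (i + 1#)                    ≡⟨ solve 3 (λ c f i → (i :+ I) :* (i :+ I) := (c :* f :+ i :* i) :+ I :+ c :* f) refl c f i ⟩
        (c * f + i * i) + 1# + c * f           ≡⟨ cong₂ (λ s t → s + 1# + t * f) (cong c₃₃ eq) c≡0 ⟩
        1# + 1# + 0# * f                       ≡⟨ solve 1 (λ f → I :+ I :+ O :* f := O) refl f ⟩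
        0#                                     ∎
      i≡1 : i ≡ 1#
      i≡1 = x+y≡0⇒x≡y i 1# (reduce (no-zero-divisors (i + 1#) (i + 1#) [i+1]²≡0))
    from : IsO3Form v → θ-pullback v ≡ θ-form
    from (c≡0 , f≡0 , i≡1 , ad≡gg , be≡hh , ae+bd≡1) = quadratic-cong
      (trans (cong (_+ g * g) ad≡gg) (x+x≡0 (g * g)))
      (trans (cong (_+ h * h) be≡hh) (x+x≡0 (h * h)))
      (trans (cong₂ (λ s t → s * f + t * t) c≡0 i≡1) (solve 1 (λ f → O :* f :+ I :* I := I) refl f))
      ae+bd≡1
      (trans (cong₂ (λ s t → a * s + t * d) f≡0 c≡0) (solve 2 (λ a d → a :* O :+ O :* d := O) refl a d))
      (trans (cong₂ (λ s t → b * s + t * e) f≡0 c≡0) (solve 2 (λ b e → b :* O :+ O :* e := O) refl b e))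

  IsO3Form⇒det≢0 : ∀ v → IsO3Form v → ¬ det F (toMat v) ≡ 0#
  IsO3Form⇒det≢0 (a ∷ b ∷ _ ∷ d ∷ e ∷ _ ∷ g ∷ h ∷ _ ∷ []) (refl , refl , refl , _ , _ , ae+bd≡1) det≡0 =
    0≢1 (trans (sym det≡0) (trans det≡ae+bd ae+bd≡1))
    where
    det≡ae+bd : det F (toMat (a ∷ b ∷ 0# ∷ d ∷ e ∷ 0# ∷ g ∷ h ∷ 1# ∷ [])) ≡ a * e + b * d
    det≡ae+bd = solve 6 (λ a b d e g h →
      a :* (e :* I :+ :- (O :* h)) :+ :- (b :* (d :* I :+ :- (O :* g))) :+ O :* (d :* h :+ :- (e :* g)) := a :* e :+ b :* d)
      refl a b d e g h

  IsO3⇔IsO3Form : ∀ v → IsO3 F (toMat v) ⇔ IsO3Form v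
  IsO3⇔IsO3Form v = mk⇔
    (λ (_ , pres) → Equivalence.to (θ-pullback≡θ-form⇔IsO3Form v) (Equivalence.to (Preservesθ⇔θ-pullback≡θ-form v) pres))
    (λ form → IsO3Form⇒det≢0 v form
            , Equivalence.from (Preservesθ⇔θ-pullback≡θ-form v) (Equivalence.from (θ-pullback≡θ-form⇔IsO3Form v) form))

  σ₁ σ₂ : Vec Carrier 9 → Vec Carrier 9
  σ₁ = addCoord (# 7) (# 1) ∘ addCoord (# 6) (# 0) ∘ addCoord (# 4) (# 1) ∘ addCoord (# 3) (# 0)
  σ₂ = addCoord (# 7) (# 4) ∘ addCoord (# 6) (# 3) ∘ addCoord (# 1) (# 4) ∘ addCoord (# 0) (# 3)

  σ₁-ΣV-invariant : ΣV-Invariant σ₁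
  σ₁-ΣV-invariant =
    ∘-ΣV-invariant (addCoord-ΣV-invariant (# 7) (# 1) (λ ())) (∘-ΣV-invariant (addCoord-ΣV-invariant (# 6) (# 0) (λ ()))
      (∘-ΣV-invariant (addCoord-ΣV-invariant (# 4) (# 1) (λ ())) (addCoord-ΣV-invariant (# 3) (# 0) (λ ()))))

  σ₂-ΣV-invariant : ΣV-Invariant σ₂
  σ₂-ΣV-invariant =
    ∘-ΣV-invariant (addCoord-ΣV-invariant (# 7) (# 4) (λ ())) (∘-ΣV-invariant (addCoord-ΣV-invariant (# 6) (# 3) (λ ()))
      (∘-ΣV-invariant (addCoord-ΣV-invariant (# 1) (# 4) (λ ())) (addCoord-ΣV-invariant (# 0) (# 3) (λ ()))))

  σ₁-IsO3Form : ∀ v → IsO3Form (σ₁ v) ⇔ IsO3Form v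
  σ₁-IsO3Form (a ∷ b ∷ c ∷ d ∷ e ∷ f ∷ g ∷ h ∷ i ∷ []) =
    ⇔-id _ ×-⇔ ⇔-id _ ×-⇔ ⇔-id _
    ×-⇔ +-cancelʳ-⇔ (a * a) (x*[y+x] a d) ([y+x]² a g)
    ×-⇔ +-cancelʳ-⇔ (b * b) (x*[y+x] b e) ([y+x]² b h)
    ×-⇔ ≡-substˡ-⇔ (solve 4 (λ a b d e → a :* (e :+ b) :+ b :* (d :+ a) := a :* e :+ b :* d) refl a b d e)
    where
    x*[y+x] : ∀ x y → x * (y + x) ≡ x * y + x * x
    x*[y+x] = solve 2 (λ x y → x :* (y :+ x) := x :* y :+ x :* x) refl
    [y+x]² : ∀ x y → (y + x) * (y + x) ≡ y * y + x * x
    [y+x]² = solve 2 (λ x y → (y :+ x) :* (y :+ x) := y :* y :+ x :* x) refl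

  σ₂-IsO3Form : ∀ v → IsO3Form (σ₂ v) ⇔ IsO3Form v
  σ₂-IsO3Form (a ∷ b ∷ c ∷ d ∷ e ∷ f ∷ g ∷ h ∷ i ∷ []) =
    ⇔-id _ ×-⇔ ⇔-id _ ×-⇔ ⇔-id _
    ×-⇔ +-cancelʳ-⇔ (d * d) ([x+y]*y a d) ([y+x]² d g)
    ×-⇔ +-cancelʳ-⇔ (e * e) ([x+y]*y b e) ([y+x]² e h)
    ×-⇔ ≡-substˡ-⇔ (solve 4 (λ a b d e → (a :+ d) :* e :+ (b :+ e) :* d := a :* e :+ b :* d) refl a b d e)
    where
    [x+y]*y : ∀ x y → (x + y) * y ≡ x * y + y * y
    [x+y]*y = solve 2 (λ x y → (x :+ y) :* y := x :* y :+ y :* y) refl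
    [y+x]² : ∀ x y → (y + x) * (y + x) ≡ y * y + x * x
    [y+x]² = solve 2 (λ x y → (y :+ x) :* (y :+ x) := y :* y :+ x :* x) refl

  χ : Vec Carrier 9 → Carrier
  χ v = 𝟙 (IsO3? F (toMat v))

  ΣV-χ*φ≡0 : (σ : Vec Carrier 9 → Vec Carrier 9) → ΣV-Invariant σ → (∀ v → IsO3Form (σ v) ⇔ IsO3Form v) →
             (L : Vec Carrier 9 → Carrier) → (∀ v → IsO3Form v → L v + L (σ v) ≡ 1#) →
             (φ : Vec Carrier 9 → Carrier) → (∀ v → φ (σ v) ≡ φ v) → ΣV 9 (λ v → χ v * φ v) ≡ 0#
  ΣV-χ*φ≡0 σ σ-inv σ-form L L-split φ φ∘σ≗φ =
    ΣV-pairing σ σ-inv (λ v → χ v * φ v) L (λ v → cong₂ _*_ (χ∘σ≗χ v) (φ∘σ≗φ v))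
      (λ v → 𝟙-support (IsO3? F (toMat v)) (φ v) (L v + L (σ v))
               (L-split v ∘ Equivalence.to (IsO3⇔IsO3Form v)))
    where
    IsO3∘σ⇔IsO3 : ∀ v → IsO3 F (toMat (σ v)) ⇔ IsO3 F (toMat v)
    IsO3∘σ⇔IsO3 v = ⇔-sym (IsO3⇔IsO3Form v) ⇔-∘ (σ-form v ⇔-∘ IsO3⇔IsO3Form (σ v))
    χ∘σ≗χ : ∀ v → χ (σ v) ≡ χ v
    χ∘σ≗χ v = cong (λ b → if b then 1# else 0#) (does-⇔ (IsO3∘σ⇔IsO3 v) (IsO3? F (toMat (σ v))) (IsO3? F (toMat v)))

  L₁ L₂ : Vec Carrier 9 → Carrier
  L₁ (a ∷ b ∷ c ∷ d ∷ e ∷ _) = d * (e + b)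
  L₂ (a ∷ b ∷ c ∷ d ∷ e ∷ _) = a * (b + e)

  L₁-split : ∀ v → IsO3Form v → L₁ v + L₁ (σ₁ v) ≡ 1#
  L₁-split (a ∷ b ∷ c ∷ d ∷ e ∷ f ∷ g ∷ h ∷ i ∷ []) (_ , _ , _ , _ , _ , ae+bd≡1) =
    trans (solve 4 (λ a b d e → d :* (e :+ b) :+ (d :+ a) :* (e :+ b :+ b) := a :* e :+ b :* d) refl a b d e) ae+bd≡1

  L₂-split : ∀ v → IsO3Form v → L₂ v + L₂ (σ₂ v) ≡ 1#
  L₂-split (a ∷ b ∷ c ∷ d ∷ e ∷ f ∷ g ∷ h ∷ i ∷ []) (_ , _ , _ , _ , _ , ae+bd≡1) =
    trans (solve 4 (λ a b d e → a :* (b :+ e) :+ (a :+ d) :* (b :+ e :+ e) := a :* e :+ b :* d) refl a b d e) ae+bd≡1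

  ΣV-χ*tr≡0 : ΣV 9 (λ v → χ v * tr F (toMat v)) ≡ 0#
  ΣV-χ*tr≡0 = begin
    ΣV 9 (λ v → χ v * tr F (toMat v))
      ≡⟨ ΣV-cong 9 (λ v → distrib₃ (χ v) (lookup v (# 0)) (lookup v (# 4)) (lookup v (# 8))) ⟩
    ΣV 9 (λ v → χ* (# 0) v + χ* (# 4) v + χ* (# 8) v) ≡⟨ ΣV-+ 9 (λ v → χ* (# 0) v + χ* (# 4) v) (χ* (# 8)) ⟩
    ΣV 9 (λ v → χ* (# 0) v + χ* (# 4) v) + ΣV 9 (χ* (# 8)) ≡⟨ cong (_+ ΣV 9 (χ* (# 8))) (ΣV-+ 9 (χ* (# 0)) (χ* (# 4))) ⟩
    ΣV 9 (χ* (# 0)) + ΣV 9 (χ* (# 4)) + ΣV 9 (χ* (# 8))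
      ≡⟨ cong₂ _+_ (cong₂ _+_ (ΣV-χ*φ≡0 σ₁ σ₁-ΣV-invariant σ₁-IsO3Form L₁ L₁-split (λ v → lookup v (# 0)) σ₁-fixes₀)
                              (ΣV-χ*φ≡0 σ₂ σ₂-ΣV-invariant σ₂-IsO3Form L₂ L₂-split (λ v → lookup v (# 4)) σ₂-fixes₄))
                   (ΣV-χ*φ≡0 σ₁ σ₁-ΣV-invariant σ₁-IsO3Form L₁ L₁-split (λ v → lookup v (# 8)) σ₁-fixes₈) ⟩
    0# + 0# + 0#                                      ≡⟨ trans (+-identityʳ (0# + 0#)) (+-identityʳ 0#) ⟩
    0#                                                ∎
    where
    open ≡-Reasoning
    χ* : Fin 9 → Vec Carrier 9 → Carrier
    χ* k v = χ v * lookup v k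
    distrib₃ : ∀ x p q r → x * (p + q + r) ≡ x * p + x * q + x * r
    distrib₃ = solve 4 (λ x p q r → x :* (p :+ q :+ r) := x :* p :+ x :* q :+ x :* r) refl
    σ₁-fixes₀ : ∀ v → lookup (σ₁ v) (# 0) ≡ lookup v (# 0)
    σ₁-fixes₀ (a ∷ b ∷ c ∷ d ∷ e ∷ f ∷ g ∷ h ∷ i ∷ []) = refl
    σ₂-fixes₄ : ∀ v → lookup (σ₂ v) (# 4) ≡ lookup v (# 4)
    σ₂-fixes₄ (a ∷ b ∷ c ∷ d ∷ e ∷ f ∷ g ∷ h ∷ i ∷ []) = refl
    σ₁-fixes₈ : ∀ v → lookup (σ₁ v) (# 8) ≡ lookup v (# 8)
    σ₁-fixes₈ (a ∷ b ∷ c ∷ d ∷ e ∷ f ∷ g ∷ h ∷ i ∷ []) = refl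

  sumF-O3≡0 : sumF F (replicate (N F) true) (fromList (O3 F)) ≡ 0#
  sumF-O3≡0 = begin
    sumF F (replicate (N F) true) (fromList (O3 F))     ≡⟨ sumF-ones (O3 F) ⟩
    ΣL (filter (IsO3? F) (allMat3 F)) (tr F)            ≡⟨ ΣL-filter (IsO3? F) (allMat3 F) (tr F) ⟩
    ΣL (allMat3 F) (λ w → 𝟙 (IsO3? F w) * tr F w)      ≡⟨ ΣL-allMat3 _ ⟩
    ΣV 9 (λ v → χ v * tr F (toMat v))                   ≡⟨ ΣV-χ*tr≡0 ⟩
    0#                                                  ∎
    where open ≡-Reasoning

  sumF∘complement≗sumF : ∀ {n} (ws : Vec (Mat3 F) n) → sumF F (replicate n true) ws ≡ 0# →
                         ∀ u → sumF F (complement u) ws ≡ sumF F u ws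
  sumF∘complement≗sumF ws Σws≡0 u = x+y≡0⇒x≡y _ _ (trans (sumF-complement u ws) Σws≡0)

corollary14 : (r : ℕ) → 1 ≤ r → (F : FiniteField) → FiniteField.size F ≡ 2 ^ r →
    ∀ j → j ≤ N F → C F j ≡ C F (N F ∸ j)
corollary14 r 1≤r F size≡2^r =
  codewordCount-symmetric (fromList (O3 F)) (sumF∘complement≗sumF (fromList (O3 F)) sumF-O3≡0)
  where
  open BinaryWords F
  open CharacteristicTwo F (FieldSums.characteristic-two F r 1≤r size≡2^r)
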